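{- The decomposition space $\mathbf K$ (described in the context) is complete, i.e. the degeneracy map $s_0\colon\mathbf K_0\to\mathbf K_1$ is a monomorphism of groupoids (its homotopy fibres are empty or contractible).
   Context: A contraction is a map of posets $f\colon P\to Q$ which is a monotone surjection, whose fibres $P_q=f^{ -1}(q)$ are connected convex subposets of $P$, and such that for every cover $q\lessdot q'$ in $Q$ (i.e. $q<q'$ with nothing strictly between) there is a cover $p\lessdot p'$ in $P$ with $f(p)=q$, $f(p')=q'$. $\mathbf K$ is the pseudosimplicial groupoid with: $\mathbf K_0$ the groupoid of finite families of one-element posets; $\mathbf K_1$ the groupoid of finite families of finite connected non-empty posets; for $n\ge2$, $\mathbf K_n$ the groupoid of finite families of chains $P_0\twoheadrightarrow\cdots\twoheadrightarrow P_{n-1}$ of contractions of finite connected non-empty posets. Componentwise on a chain: $d_0$ deletes $P_0$, inner faces compose, $d_{n-1}$ deletes $P_{n-1}$, the top face $d_n$ returns the family of fibre chains over the elements of $P_{n-1}$; on $\mathbf K_1$, $d_0$ sends $P$ to the one-element poset and $d_1$ sends $P$ to the family of one-element posets indexed by $P$; degeneracies insert identities, $s_0\colon\mathbf K_0\to\mathbf K_1$ is the inclusion of (families of) one-element posets, top degeneracies append $P_{n-1}\twoheadrightarrow1$. $\mathbf K$ is a decomposition space. -}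

module Defs where

open import Level using (0ℓ)
open import Data.Nat using (ℕ; zero; suc; _<_; s≤s; z≤n)
open import Data.Fin using (Fin; zero; suc)
open import Data.Product using (Σ; _×_; _,_; proj₁; proj₂)
open import Data.Sum using (_⊎_)
open import Function.Bundles using (_↔_; Inverse)
open import Relation.Binary.Structures using (IsPartialOrder)
open import Relation.Binary.PropositionalEquality using (_≡_; refl; subst)
open import Relation.Binary.Construct.Closure.ReflexiveTransitive using (Star; ε)

record FinPoset : Set₁ where
  field
    size      : ℕ
    _≤_       : Fin size → Fin size → Set
    isPartialOrder : IsPartialOrder _≡_ _≤_
open FinPoset public

NonEmpty : FinPoset → Set
NonEmpty P = 0 < size P

Comparable : (P : FinPoset) → Fin (size P) → Fin (size P) → Set
Comparable P x y = _≤_ P x y ⊎ _≤_ P y x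

Connected : FinPoset → Set
Connected P = ∀ x y → Star (Comparable P) x y

record OrderIso (P Q : FinPoset) : Set where
  field
    bij     : Fin (size P) ↔ Fin (size Q)
  to : Fin (size P) → Fin (size Q)
  to = Inverse.to bij
  field
    mono    : ∀ {x y} → _≤_ P x y → _≤_ Q (to x) (to y)
    reflect : ∀ {x y} → _≤_ Q (to x) (to y) → _≤_ P x y
open OrderIso public

record Fam (A : Set₁) : Set₁ where
  field
    len : ℕ
    at  : Fin len → A
open Fam public

record FamIso {A : Set₁} (U : A → FinPoset) (F G : Fam A) : Set where
  field
    σ : Fin (len F) ↔ Fin (len G)
    φ : ∀ i → OrderIso (U (at F i)) (U (at G (Inverse.to σ i)))
open FamIso public

FamIsoEq : {A : Set₁} {U : A → FinPoset} {F G : Fam A} →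
           FamIso U F G → FamIso U F G → Set
FamIsoEq {U = U} {F} {G} f g =
  ∀ i → Σ (Inverse.to (σ f) i ≡ Inverse.to (σ g) i) λ p →
    ∀ x → subst (λ j → Fin (size (U (at G j)))) p (to (φ f i) x)
          ≡ to (φ g i) x

OnePoset : Set₁
OnePoset = Σ FinPoset λ P → size P ≡ 1

K₀ : Set₁
K₀ = Fam OnePoset

K₀Hom : K₀ → K₀ → Set
K₀Hom = FamIso proj₁

K₀HomEq : {a b : K₀} → K₀Hom a b → K₀Hom a b → Set
K₀HomEq = FamIsoEq

ConnPoset : Set₁
ConnPoset = Σ FinPoset λ P → NonEmpty P × Connected P

K₁ : Set₁
K₁ = Fam ConnPoset

K₁Hom : K₁ → K₁ → Set
K₁Hom = FamIso proj₁

K₁HomEq : {a b : K₁} → K₁Hom a b → K₁Hom a b → Set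
K₁HomEq = FamIsoEq

private
  fin1-unique : ∀ {n} → n ≡ 1 → (x y : Fin n) → x ≡ y
  fin1-unique refl zero zero = refl

  one-nonempty : ∀ {n} → n ≡ 1 → 0 < n
  one-nonempty refl = s≤s z≤n

one-conn : (P : FinPoset) → size P ≡ 1 → NonEmpty P × Connected P
one-conn P e = one-nonempty e , λ x y → subst (Star (Comparable P) x) (fin1-unique e x y) ε

s₀ : K₀ → K₁
s₀ a = record { len = len a
              ; at = λ i → proj₁ (at a i) , one-conn (proj₁ (at a i)) (proj₂ (at a i)) }

s₀-hom : {a b : K₀} → K₀Hom a b → K₁Hom (s₀ a) (s₀ b)
s₀-hom f = record { σ = σ f ; φ = φ f }

-- A functor of groupoids is a monomorphism iff it is fully faithful.
FullyFaithful-s₀ : Set₁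
FullyFaithful-s₀ =
  ∀ (a b : K₀) →
    (∀ (f g : K₀Hom a b) → K₁HomEq (s₀-hom f) (s₀-hom g) → K₀HomEq f g)
    × (∀ (h : K₁Hom (s₀ a) (s₀ b)) → Σ (K₀Hom a b) λ f → K₁HomEq (s₀-hom f) h)

{-# OPTIONS --safe #-}
module Submission where

open import Defs
open import Data.Product using (Σ; _×_; _,_)
open import Relation.Binary.PropositionalEquality using (refl)

-- s₀ leaves the underlying posets untouched, so it is the inclusion of a full
-- subgroupoid: a morphism of K₁ between images of s₀, and an equality of two
-- such morphisms, is literally the same data as in K₀.

FamIsoEq-refl : {A : Set₁} {U : A → FinPoset} {F G : Fam A} →
                (f : FamIso U F G) → FamIsoEq f f
FamIsoEq-refl f i = refl , λ x → refl

s₀-faithful : ∀ {a b} (f g : K₀Hom a b) → K₁HomEq (s₀-hom f) (s₀-hom g) → K₀HomEq f g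
s₀-faithful f g f≈g = f≈g

s₀-full : ∀ {a b} (h : K₁Hom (s₀ a) (s₀ b)) → Σ (K₀Hom a b) λ f → K₁HomEq (s₀-hom f) h
s₀-full h = record { σ = σ h ; φ = φ h } , FamIsoEq-refl h

proposition3p9 : ∀ (a b : K₀) → (∀ (f g : K₀Hom a b) → K₁HomEq (s₀-hom f) (s₀-hom g) → K₀HomEq f g) × (∀ (h : K₁Hom (s₀ a) (s₀ b)) → Σ (K₀Hom a b) λ f → K₁HomEq (s₀-hom f) h)
proposition3p9 a b = s₀-faithful , s₀-full
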